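{- Let $\mathbf u$ be an infinite word over a finite alphabet containing only finitely many distinct palindromes as factors. Then $2D(\mathbf u)=\sum_{n=0}^{+\infty}T_{\mathbf u}(n)$ (both sides being $+\infty$).
   Context: $\mathcal C_{\mathbf u}(n)$ is the number of distinct factors of length $n$ of $\mathbf u$, $\mathcal P_{\mathbf u}(n)$ the number of palindromic factors of length $n$, and $T_{\mathbf u}(n)=\mathcal C_{\mathbf u}(n+1)-\mathcal C_{\mathbf u}(n)+2-\mathcal P_{\mathbf u}(n+1)-\mathcal P_{\mathbf u}(n)$. The defect of a finite word $w$ is $|w|+1$ minus the number of distinct palindromic factors of $w$ (including the empty word); $D(\mathbf u)$ is the supremum of the defects of the prefixes of $\mathbf u$. -}

module Defs where

open import Data.Nat using (ℕ; zero; suc; _+_; _∸_; _≤_)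
open import Data.Fin using (Fin; toℕ)
open import Data.Integer as ℤ using (ℤ; +_)
open import Data.List using (List; []; _∷_; length; reverse; tabulate; inits; tails; concatMap; filter; deduplicate)
open import Data.List.Properties using (≡-dec)
open import Data.List.Relation.Unary.Unique.Propositional using (Unique)
open import Data.List.Membership.Propositional using (_∈_)
open import Data.Product using (Σ; ∃; _×_)
open import Relation.Binary.PropositionalEquality using (_≡_)
open import Relation.Nullary using (Dec)
import Data.Fin as F

Word : ℕ → Set
Word k = ℕ → Fin k

factorAt : ∀ {k} → Word k → ℕ → ℕ → List (Fin k)
factorAt u i n = tabulate {n = n} (λ j → u (i + toℕ j))

IsFactor : ∀ {k} → Word k → List (Fin k) → Set
IsFactor u w = ∃ λ i → w ≡ factorAt u i (length w)

IsPal : ∀ {k} → List (Fin k) → Set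
IsPal w = w ≡ reverse w

isPal? : ∀ {k} (w : List (Fin k)) → Dec (IsPal w)
isPal? w = ≡-dec F._≟_ w (reverse w)

prefix : ∀ {k} → Word k → ℕ → List (Fin k)
prefix u n = factorAt u 0 n

-- Number of distinct palindromic factors of a finite word (empty word included).
palCount : ∀ {k} → List (Fin k) → ℕ
palCount w = length (deduplicate (≡-dec F._≟_) (filter isPal? (concatMap inits (tails w))))

-- Defect of a finite word: |w| + 1 − #palindromic factors (this is always ≥ 0).
defect : ∀ {k} → List (Fin k) → ℕ
defect w = suc (length w) ∸ palCount w

CountIs : ∀ {k} → (List (Fin k) → Set) → ℕ → Set
CountIs {k} P c = Σ (List (List (Fin k))) λ L →
  Unique L × (∀ w → w ∈ L → P w) × (∀ w → P w → w ∈ L) × length L ≡ c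

FactorComplexityIs : ∀ {k} → Word k → ℕ → ℕ → Set
FactorComplexityIs u n c = CountIs (λ w → IsFactor u w × length w ≡ n) c

PalComplexityIs : ∀ {k} → Word k → ℕ → ℕ → Set
PalComplexityIs u n c = CountIs (λ w → IsFactor u w × IsPal w × length w ≡ n) c

FinitelyManyPals : ∀ {k} → Word k → Set
FinitelyManyPals {k} u = Σ (List (List (Fin k))) λ L → ∀ w → IsFactor u w → IsPal w → w ∈ L

Tval : (ℕ → ℕ) → (ℕ → ℕ) → ℕ → ℤ
Tval C P n = ((((+ C (suc n)) ℤ.- (+ C n)) ℤ.+ (+ 2)) ℤ.- (+ P (suc n))) ℤ.- (+ P n)

partialT : (ℕ → ℕ) → (ℕ → ℕ) → ℕ → ℤ
partialT C P zero = + 0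
partialT C P (suc N) = partialT C P N ℤ.+ Tval C P N

DefectInfinite : ∀ {k} → Word k → Set
DefectInfinite u = ∀ (M : ℕ) → ∃ λ n → M ≤ defect (prefix u n)

SumDivergesToInfinity : (ℕ → ℕ) → (ℕ → ℕ) → Set
SumDivergesToInfinity C P = ∀ (M : ℤ) → ∃ λ N → ∀ m → N ≤ m → M ℤ.≤ partialT C P m

-- A prefix of u contains only palindromes that are factors of u, so if u has just K
-- palindromic factors the prefix of length n has defect at least n + 1 − K, which is
-- unbounded.  On the other side, Σ_{n<m} T(n) telescopes to
-- 𝒞(m) − 𝒞(0) + 2m − Σ_{n<m} (𝒫(n+1) + 𝒫(n)); since 𝒫 vanishes beyond the length of the
-- longest palindromic factor, the last sum is eventually constant while 2m grows.
module Submission where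

open import Defs
open import Data.Nat using (ℕ; zero; suc; _+_; _∸_; _≤_; _<_; _≤′_; ≤′-refl; ≤′-step; z≤n; s≤s)
open import Data.Nat.Properties
open import Data.Fin using (Fin)
import Data.Fin as F
open import Data.Integer as ℤ using (ℤ; +_; -[1+_]; ∣_∣)
import Data.Integer.Properties as ℤP
open import Data.Integer.Solver using (module +-*-Solver)
open import Data.List using (List; []; _∷_; length; inits; tails; concatMap; filter; deduplicate)
open import Data.List.Properties using (≡-dec; length-tabulate; filter-notAll)
open import Data.List.Extrema.Nat using (argmax; f[xs]≤f[argmax])
open import Data.List.Relation.Unary.All as All using ()
open import Data.List.Relation.Unary.Any as Any using (Any; here; there)
open import Data.List.Relation.Unary.AllPairs using (_∷_)
open import Data.List.Relation.Unary.Unique.Propositional using (Unique)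
open import Data.List.Relation.Unary.Unique.DecPropositional.Properties using (deduplicate-!)
open import Data.List.Relation.Binary.Subset.Propositional using (_⊆_)
open import Data.List.Membership.Propositional using (_∈_; find)
open import Data.List.Membership.Propositional.Properties
  using (∈-filter⁺; ∈-filter⁻; ∈-map⁻; ∈-concatMap⁻; ∈-deduplicate⁻)
open import Data.Product using (_×_; _,_)
open import Data.Sum using (inj₁; inj₂)
open import Data.Empty using (⊥-elim)
open import Relation.Binary.Definitions using (DecidableEquality)
open import Relation.Binary.PropositionalEquality using (_≡_; _≢_; refl; sym; trans; cong; cong₂; subst)
open import Relation.Nullary using (¬_; ¬?; Dec)

Unique⇒length≤ : ∀ {A : Set} → DecidableEquality A →
  ∀ {xs ys : List A} → Unique xs → xs ⊆ ys → length xs ≤ length ys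
Unique⇒length≤ _≟_ {[]} _ _ = z≤n
Unique⇒length≤ {A} _≟_ {x ∷ xs} {ys} (x∉xs ∷ xs!) x∷xs⊆ys =
  ≤-trans (s≤s (Unique⇒length≤ _≟_ xs! xs⊆ys-x)) (filter-notAll ≢x? ys x∈ys)
  where
    ≢x? : (y : A) → Dec (x ≢ y)
    ≢x? y = ¬? (x ≟ y)
    xs⊆ys-x : xs ⊆ filter ≢x? ys
    xs⊆ys-x w∈xs = ∈-filter⁺ ≢x? (x∷xs⊆ys (there w∈xs)) (All.lookup x∉xs w∈xs)
    x∈ys : Any (λ y → ¬ x ≢ y) ys
    x∈ys = Any.map (λ x≡y x≢y → x≢y x≡y) (x∷xs⊆ys (here refl))

CountIs-empty : ∀ {k} {P : List (Fin k) → Set} {c} → (∀ w → ¬ P w) → CountIs P c → c ≡ 0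
CountIs-empty ¬P ([] , _ , _ , _ , len≡c) = sym len≡c
CountIs-empty ¬P ((w ∷ _) , _ , sound , _) = ⊥-elim (¬P w (sound w (here refl)))

length-prefix : ∀ {k} (u : Word k) n → length (prefix u n) ≡ n
length-prefix u n = length-tabulate (λ j → u (F.toℕ j))

inits-prefix : ∀ {k} (u : Word k) n {w} → w ∈ inits (prefix u n) → w ≡ prefix u (length w)
inits-prefix u zero (here refl) = refl
inits-prefix u (suc n) (here refl) = refl
inits-prefix u (suc n) (there w∈) with ∈-map⁻ (u 0 ∷_) w∈
... | v , v∈ , refl = cong (u 0 ∷_) (inits-prefix (λ i → u (suc i)) n v∈)

tails-prefix : ∀ {k} (u : Word k) n {t} → t ∈ tails (prefix u n) → IsFactor u t
tails-prefix u zero (here refl) = 0 , refl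
tails-prefix u (suc n) (here refl) = 0 , cong (prefix u) (sym (length-prefix u (suc n)))
tails-prefix u (suc n) (there t∈) with tails-prefix (λ i → u (suc i)) n t∈
... | i , t≡ = suc i , t≡

infix-prefix⇒IsFactor : ∀ {k} (u : Word k) n {w} →
  w ∈ concatMap inits (tails (prefix u n)) → IsFactor u w
infix-prefix⇒IsFactor u n {w} w∈ with find (∈-concatMap⁻ inits {xs = tails (prefix u n)} w∈)
... | t , t∈ , w∈inits-t with tails-prefix u n t∈
... | i , t≡ = i , inits-prefix (λ j → u (i + j)) (length t) (subst (λ s → w ∈ inits s) t≡ w∈inits-t)

palCount-prefix-≤ : ∀ {k} (u : Word k) (L : List (List (Fin k))) →
  (∀ w → IsFactor u w → IsPal w → w ∈ L) → ∀ n → palCount (prefix u n) ≤ length L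
palCount-prefix-≤ {k} u L pals⊆L n =
  Unique⇒length≤ (≡-dec F._≟_) (deduplicate-! (≡-dec F._≟_) infixPals) palCounted⊆L
  where
    infixPals : List (List (Fin k))
    infixPals = filter isPal? (concatMap inits (tails (prefix u n)))
    palCounted⊆L : deduplicate (≡-dec F._≟_) infixPals ⊆ L
    palCounted⊆L w∈ with ∈-filter⁻ isPal? (∈-deduplicate⁻ (≡-dec F._≟_) infixPals w∈)
    ... | w∈infixes , pal = pals⊆L _ (infix-prefix⇒IsFactor u n w∈infixes) pal

palCount-bounded⇒DefectInfinite : ∀ {k} (u : Word k) K →
  (∀ n → palCount (prefix u n) ≤ K) → DefectInfinite u
palCount-bounded⇒DefectInfinite u K bounded M = M + K , (begin
  M                                          ≡⟨ sym (m+n∸n≡m M K) ⟩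
  M + K ∸ K                                  ≤⟨ ∸-mono (n≤1+n (M + K)) (bounded (M + K)) ⟩
  suc (M + K) ∸ palCount (prefix u (M + K))  ≡⟨ cong (λ ℓ → suc ℓ ∸ palCount (prefix u (M + K)))
                                                     (sym (length-prefix u (M + K))) ⟩
  defect (prefix u (M + K))                  ∎)
  where open ≤-Reasoning

PalComplexity-vanishes : ∀ {k} (u : Word k) (L : List (List (Fin k))) →
  (∀ w → IsFactor u w → IsPal w → w ∈ L) →
  ∀ {n c} → length (argmax length [] L) < n → PalComplexityIs u n c → c ≡ 0
PalComplexity-vanishes u L pals⊆L {n} longest<n = CountIs-empty noPal
  where
    noPal : ∀ w → ¬ (IsFactor u w × IsPal w × length w ≡ n)
    noPal w (factor , pal , refl) =
      <⇒≱ longest<n (All.lookup (f[xs]≤f[argmax] [] L) (pals⊆L w factor pal))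

partialSum : (ℕ → ℕ) → ℕ → ℕ
partialSum f zero = 0
partialSum f (suc m) = partialSum f m + f m

partialSum-mono-≤ : ∀ f {m n} → m ≤ n → partialSum f m ≤ partialSum f n
partialSum-mono-≤ f m≤n = mono (≤⇒≤′ m≤n)
  where
    mono : ∀ {m n} → m ≤′ n → partialSum f m ≤ partialSum f n
    mono ≤′-refl = ≤-refl
    mono (≤′-step m≤n) = ≤-trans (mono m≤n) (m≤m+n _ _)

partialSum-stable : ∀ f {N} → (∀ n → N ≤ n → f n ≡ 0) →
  ∀ {m} → N ≤ m → partialSum f m ≡ partialSum f N
partialSum-stable f {N} vanishes N≤m = stable (≤⇒≤′ N≤m)
  where
    stable : ∀ {m} → N ≤′ m → partialSum f m ≡ partialSum f N
    stable ≤′-refl = refl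
    stable (≤′-step {n} N≤n) =
      trans (cong₂ _+_ (stable N≤n) (vanishes n (≤′⇒≤ N≤n))) (+-identityʳ _)

eventually-zero⇒partialSum-≤ : ∀ f N → (∀ n → N ≤ n → f n ≡ 0) →
  ∀ m → partialSum f m ≤ partialSum f N
eventually-zero⇒partialSum-≤ f N vanishes m with ≤-total m N
... | inj₁ m≤N = partialSum-mono-≤ f m≤N
... | inj₂ N≤m = ≤-reflexive (partialSum-stable f vanishes N≤m)

palPairSum : (ℕ → ℕ) → ℕ → ℕ
palPairSum P = partialSum (λ n → P (suc n) + P n)

partialT-telescopes : ∀ C P m →
  partialT C P m ≡ + (C m + (m + m)) ℤ.- + (C 0 + palPairSum P m)
partialT-telescopes C P zero = sym (ℤP.+-inverseʳ (+ (C 0 + 0)))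
partialT-telescopes C P (suc m) =
  trans (cong (ℤ._+ Tval C P m) (partialT-telescopes C P m))
        (telescope-step (+ C m) (+ C (suc m)) (+ C 0) (+ palPairSum P m) (+ P (suc m)) (+ P m) (+ m))
  where
    open +-*-Solver using (solve; _:+_; _:-_; con; _:=_)
    telescope-step : ∀ c c′ c₀ s p′ p x →
      ((c ℤ.+ (x ℤ.+ x)) ℤ.- (c₀ ℤ.+ s)) ℤ.+ ((((c′ ℤ.- c) ℤ.+ + 2) ℤ.- p′) ℤ.- p)
      ≡ (c′ ℤ.+ ((+ 1 ℤ.+ x) ℤ.+ (+ 1 ℤ.+ x))) ℤ.- (c₀ ℤ.+ (s ℤ.+ (p′ ℤ.+ p)))
    telescope-step = solve 7 (λ c c′ c₀ s p′ p x →
      ((c :+ (x :+ x)) :- (c₀ :+ s)) :+ ((((c′ :- c) :+ con (+ 2)) :- p′) :- p)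
      := (c′ :+ ((con (+ 1) :+ x) :+ (con (+ 1) :+ x))) :- (c₀ :+ (s :+ (p′ :+ p)))) refl

i≤+∣i∣ : ∀ i → i ℤ.≤ + ∣ i ∣
i≤+∣i∣ (+ n) = ℤP.≤-refl
i≤+∣i∣ -[1+ n ] = ℤ.-≤+

+-≤-difference : ∀ {j a b} → j + b ≤ a → + j ℤ.≤ + a ℤ.- + b
+-≤-difference {j} {a} {b} gap =
  subst (+ j ℤ.≤_) (sym (trans (ℤP.[+m]-[+n]≡m⊖n a b) (ℤP.⊖-≥ (m+n≤o⇒n≤o j gap))))
        (ℤ.+≤+ (m+n≤o⇒m≤o∸n j gap))

palPairSum-bounded⇒SumDivergesToInfinity : ∀ C P B →
  (∀ m → palPairSum P m ≤ B) → SumDivergesToInfinity C P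
palPairSum-bounded⇒SumDivergesToInfinity C P B bounded M = ∣ M ∣ + (C 0 + B) , diverges
  where
    diverges : ∀ m → ∣ M ∣ + (C 0 + B) ≤ m → M ℤ.≤ partialT C P m
    diverges m N≤m = begin
      M                                            ≤⟨ i≤+∣i∣ M ⟩
      + ∣ M ∣                                      ≤⟨ +-≤-difference gap ⟩
      + (C m + (m + m)) ℤ.- + (C 0 + palPairSum P m) ≡⟨ sym (partialT-telescopes C P m) ⟩
      partialT C P m                               ∎
      where
        open ℤP.≤-Reasoning
        gap : ∣ M ∣ + (C 0 + palPairSum P m) ≤ C m + (m + m)
        gap = ≤-trans (+-monoʳ-≤ ∣ M ∣ (+-monoʳ-≤ (C 0) (bounded m)))
                        (≤-trans N≤m (≤-trans (m≤m+n m m) (m≤n+m (m + m) (C m))))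

mainTheorem7 : ∀ (k : ℕ) (u : Word k) → FinitelyManyPals u →
    ∀ (C P : ℕ → ℕ) → (∀ n → FactorComplexityIs u n (C n)) → (∀ n → PalComplexityIs u n (P n)) →
    DefectInfinite u × SumDivergesToInfinity C P
mainTheorem7 _ u (L , pals⊆L) C P _ hP =
    palCount-bounded⇒DefectInfinite u (length L) (palCount-prefix-≤ u L pals⊆L)
  , palPairSum-bounded⇒SumDivergesToInfinity C P _
      (eventually-zero⇒partialSum-≤ _ N pairs-vanish)
  where
    N : ℕ
    N = suc (length (argmax length [] L))
    P-vanishes : ∀ n → N ≤ n → P n ≡ 0
    P-vanishes n N≤n = PalComplexity-vanishes u L pals⊆L N≤n (hP n)
    pairs-vanish : ∀ n → N ≤ n → P (suc n) + P n ≡ 0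
    pairs-vanish n N≤n = cong₂ _+_ (P-vanishes (suc n) (m≤n⇒m≤1+n N≤n)) (P-vanishes n N≤n)
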